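{- Let $p$ be a prime, let $n$ be a positive integer and let $k\ge0$ be an integer with $n<\sigma_{k+1}$. Let $n_{k+1}=n$, and for $j=k,k-1,\dots,0$ (in decreasing order), given $n_{j+1}$, let $b_j$ be the largest integer such that $b_j\sigma_j\le n_{j+1}$, and let $n_j=n_{j+1}-b_j\sigma_j$. Then for $0\le j\le k$ we have $0\le n_{j+1}\le p\sigma_j$ and $0\le b_j\le p$. Moreover, $$n=\sum_{j=0}^k b_j\sigma_j,$$ and if $b_j=p$ for some $j$, then $b_i=0$ for all $i<j$.
   Context: For an integer $k\ge 0$, $\sigma_k=\sum_{j=0}^k p^j$. -}

module Defs where

open import Data.Nat using (ℕ; zero; suc; _+_; _*_; _^_)

σ : ℕ → ℕ → ℕ
σ p zero    = 1
σ p (suc k) = σ p k + p ^ suc k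

sumTo : ℕ → (ℕ → ℕ) → ℕ
sumTo zero    f = f 0
sumTo (suc k) f = sumTo k f + f (suc k)

module Submission where

open import Defs
open import Data.Nat using (ℕ; zero; suc; _+_; _*_; _∸_; _^_; _≤_; _<_; NonZero; z≤n; s≤s⁻¹; _≤?_)
open import Data.Nat.Properties
open import Data.Nat.Primality using (Prime)
open import Data.Product using (_×_; _,_)
open import Data.Sum using (inj₁; inj₂)
open import Relation.Binary.PropositionalEquality
open import Relation.Nullary using (yes; no; contradiction)

-- Since σ_{j+1} = 1 + p σ_j, every remainder n_{j+1} < σ_{j+1} left by the greedy
-- step above it is at most p σ_j, which caps the digit b_j by p; and b_j = p
-- forces n_j = 0, after which all lower remainders and digits vanish.

σ-suc : ∀ p j → σ p (suc j) ≡ suc (p * σ p j)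
σ-suc p zero    = refl
σ-suc p (suc j) = begin
  σ p (suc j) + p * p ^ suc j          ≡⟨ cong (_+ p * p ^ suc j) (σ-suc p j) ⟩
  suc (p * σ p j + p * p ^ suc j)      ≡⟨ cong suc (*-distribˡ-+ p (σ p j) (p ^ suc j)) ⟨
  suc (p * σ p (suc j))                ∎
  where open ≡-Reasoning

σ-nonZero : ∀ p j → NonZero (σ p j)
σ-nonZero p zero = _
σ-nonZero p (suc j) rewrite σ-suc p j = _

m∸q*s<s : ∀ m q s → .{{NonZero s}} → (∀ c → c * s ≤ m → c ≤ q) → m ∸ q * s < s
m∸q*s<s m q s maximal with suc q * s ≤? m
... | yes q+1-fits = contradiction (maximal (suc q) q+1-fits) (<-irrefl refl)
... | no  q+1-exceeds =
  m<n+o⇒m∸n<o m (q * s) (subst (m <_) (+-comm s (q * s)) (≰⇒> q+1-exceeds))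

sumTo-telescope : ∀ (a f : ℕ → ℕ) k → a 0 ≡ 0 →
  (∀ m → m ≤ k → a (suc m) ≡ a m + f m) → a (suc k) ≡ sumTo k f
sumTo-telescope a f zero a0 step = trans (step 0 z≤n) (cong (_+ f 0) a0)
sumTo-telescope a f (suc k) a0 step =
  trans (step (suc k) ≤-refl)
        (cong (_+ f (suc k)) (sumTo-telescope a f k a0 (λ m m≤k → step m (m≤n⇒m≤1+n m≤k))))

mono-≤-upTo : ∀ (a : ℕ → ℕ) j → (∀ m → m < j → a m ≤ a (suc m)) → ∀ i → i ≤ j → a i ≤ a j
mono-≤-upTo a zero    _   i i≤0 rewrite n≤0⇒n≡0 i≤0 = ≤-refl
mono-≤-upTo a (suc j) inc i i≤j+1 with m≤n⇒m<n∨m≡n i≤j+1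
... | inj₂ refl = ≤-refl
... | inj₁ i<j+1 =
  ≤-trans (mono-≤-upTo a j (λ m m<j → inc m (m<n⇒m<1+n m<j)) i (s≤s⁻¹ i<j+1)) (inc j ≤-refl)

module GreedyExpansion (p k : ℕ) (b nn : ℕ → ℕ)
  (fits : ∀ j → j ≤ k → b j * σ p j ≤ nn (suc j))
  (maximal : ∀ j → j ≤ k → ∀ c → c * σ p j ≤ nn (suc j) → c ≤ b j)
  (remainder : ∀ j → j ≤ k → nn j ≡ nn (suc j) ∸ b j * σ p j)
  where

  digit : ℕ → ℕ
  digit j = b j * σ p j

  nn-suc : ∀ j → j ≤ k → nn (suc j) ≡ nn j + digit j
  nn-suc j j≤k = begin
    nn (suc j)                             ≡⟨ m∸n+n≡m (fits j j≤k) ⟨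
    nn (suc j) ∸ digit j + digit j         ≡⟨ cong (_+ digit j) (remainder j j≤k) ⟨
    nn j + digit j                         ∎
    where open ≡-Reasoning

  nn<σ : ∀ j → j ≤ k → nn j < σ p j
  nn<σ j j≤k = subst (_< σ p j) (sym (remainder j j≤k))
    (m∸q*s<s (nn (suc j)) (b j) (σ p j) {{σ-nonZero p j}} (maximal j j≤k))

  nn-zero : nn 0 ≡ 0
  nn-zero = n<1⇒n≡0 (nn<σ 0 z≤n)

  nn-sum : nn (suc k) ≡ sumTo k digit
  nn-sum = sumTo-telescope nn digit k nn-zero nn-suc

  nn-mono : ∀ i j → i ≤ j → j ≤ suc k → nn i ≤ nn j
  nn-mono i j i≤j j≤k+1 = mono-≤-upTo nn j
    (λ m m<j → subst (nn m ≤_) (sym (nn-suc m (s≤s⁻¹ (<-≤-trans m<j j≤k+1)))) (m≤m+n (nn m) (digit m)))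
    i i≤j

  module _ (top< : nn (suc k) < σ p (suc k)) where

    nn-suc≤p*σ : ∀ j → j ≤ k → nn (suc j) ≤ p * σ p j
    nn-suc≤p*σ j j≤k = s≤s⁻¹ (subst (nn (suc j) <_) (σ-suc p j) (nn-suc<σ-suc j≤k))
      where
      nn-suc<σ-suc : j ≤ k → nn (suc j) < σ p (suc j)
      nn-suc<σ-suc j≤k with m≤n⇒m<n∨m≡n j≤k
      ... | inj₁ j<k  = nn<σ (suc j) j<k
      ... | inj₂ refl = top<

    b≤p : ∀ j → j ≤ k → b j ≤ p
    b≤p j j≤k = *-cancelʳ-≤ (b j) p (σ p j) {{σ-nonZero p j}}
      (≤-trans (fits j j≤k) (nn-suc≤p*σ j j≤k))

    b≡p⇒nn≡0 : ∀ j → j ≤ k → b j ≡ p → nn j ≡ 0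
    b≡p⇒nn≡0 j j≤k b≡p = trans (remainder j j≤k)
      (m≤n⇒m∸n≡0 (subst (λ q → nn (suc j) ≤ q * σ p j) (sym b≡p) (nn-suc≤p*σ j j≤k)))

    b≡p⇒lower-b≡0 : ∀ j → j ≤ k → b j ≡ p → ∀ i → i < j → b i ≡ 0
    b≡p⇒lower-b≡0 j j≤k b≡p i i<j = n≤0⇒n≡0 (*-cancelʳ-≤ (b i) 0 (σ p i) {{σ-nonZero p i}} (begin
      b i * σ p i     ≤⟨ fits i (≤-trans (<⇒≤ i<j) j≤k) ⟩
      nn (suc i)      ≤⟨ nn-mono (suc i) j i<j (m≤n⇒m≤1+n j≤k) ⟩
      nn j            ≡⟨ b≡p⇒nn≡0 j j≤k b≡p ⟩
      0               ∎))
      where open ≤-Reasoning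

claim2p4 : (p n k : ℕ) → Prime p → 0 < n → n < σ p (suc k) →
    (b nn : ℕ → ℕ) →
    nn (suc k) ≡ n →
    (∀ j → j ≤ k → b j * σ p j ≤ nn (suc j)) →
    (∀ j → j ≤ k → ∀ c → c * σ p j ≤ nn (suc j) → c ≤ b j) →
    (∀ j → j ≤ k → nn j ≡ nn (suc j) ∸ b j * σ p j) →
    (∀ j → j ≤ k → nn (suc j) ≤ p * σ p j × b j ≤ p)
    × n ≡ sumTo k (λ j → b j * σ p j)
    × (∀ j → j ≤ k → b j ≡ p → ∀ i → i < j → b i ≡ 0)
claim2p4 p n k _ _ n< b nn nn-top fits maximal remainder =
  (λ j j≤k → nn-suc≤p*σ top< j j≤k , b≤p top< j j≤k) ,
  trans (sym nn-top) nn-sum ,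
  b≡p⇒lower-b≡0 top<
  where
  open GreedyExpansion p k b nn fits maximal remainder
  top< : nn (suc k) < σ p (suc k)
  top< = subst (_< σ p (suc k)) (sym nn-top) n<
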